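{- Let $G=(V,E)$ be a finite simple undirected graph with complement $G^c$. Suppose that (P2) every edge $e\in E$ lies in a unique triangle (3-cycle) of $G$, and (P3) every non-edge $e\in E^c$ lies in a unique quadrilateral (4-cycle) of $G^c$. Then $G$ contains no quadrilateral (cycle of length 4).
   Context: A triangle is a cycle of length 3 and a quadrilateral is a cycle of length 4, regarded as subgraphs; $G^c$ is the graph on $V$ whose edges are the pairs of distinct vertices not joined in $G$. -}

module Defs where

open import Data.Nat using (ℕ)
open import Data.Fin using (Fin)
open import Data.Product using (_×_; Σ; ∃; ∃-syntax; _,_)
open import Data.Sum using (_⊎_)
open import Relation.Nullary using (¬_)
open import Relation.Binary.PropositionalEquality using (_≡_; _≢_)

record SimpleGraph (n : ℕ) : Set₁ where
  field
    Adj       : Fin n → Fin n → Set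
    symm      : ∀ {x y} → Adj x y → Adj y x
    irrefl    : ∀ {x} → ¬ Adj x x
open SimpleGraph public

complement : ∀ {n} → SimpleGraph n → SimpleGraph n
complement G = record
  { Adj    = λ x y → (x ≢ y) × ¬ Adj G x y
  ; symm   = λ { (x≢y , ¬a) → (λ e → x≢y (Relation.Binary.PropositionalEquality.sym e)) , (λ a → ¬a (symm G a)) }
  ; irrefl = λ { (x≢x , _) → x≢x Relation.Binary.PropositionalEquality.refl }
  }

SameEdge : ∀ {n} → Fin n → Fin n → Fin n → Fin n → Set
SameEdge x y u v = (x ≡ u × y ≡ v) ⊎ (x ≡ v × y ≡ u)

-- A triangle in G: three vertices a,b,c that are pairwise adjacent
-- (the cycle a-b-c-a; adjacency forces distinctness).
record Triangle {n} (G : SimpleGraph n) : Set where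
  constructor tri
  field
    a b c : Fin n
    ab : Adj G a b
    bc : Adj G b c
    ca : Adj G c a

record Quadrilateral {n} (G : SimpleGraph n) : Set where
  constructor quad
  field
    a b c d : Fin n
    a≢c : a ≢ c
    b≢d : b ≢ d
    ab : Adj G a b
    bc : Adj G b c
    cd : Adj G c d
    da : Adj G d a

EdgeOfTri : ∀ {n} {G : SimpleGraph n} → Fin n → Fin n → Triangle G → Set
EdgeOfTri u v t = SameEdge u v a b ⊎ SameEdge u v b c ⊎ SameEdge u v c a
  where open Triangle t

EdgeOfQuad : ∀ {n} {G : SimpleGraph n} → Fin n → Fin n → Quadrilateral G → Set
EdgeOfQuad u v q = SameEdge u v a b ⊎ SameEdge u v b c ⊎ SameEdge u v c d ⊎ SameEdge u v d a
  where open Quadrilateral q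

-- Two triangles / quadrilaterals are the same subgraph iff they have
-- the same edge set (for cycles, the vertex set is determined by edges).
SameTri : ∀ {n} {G : SimpleGraph n} → Triangle G → Triangle G → Set
SameTri t t' = ∀ u v → (EdgeOfTri u v t → EdgeOfTri u v t') × (EdgeOfTri u v t' → EdgeOfTri u v t)

SameQuad : ∀ {n} {G : SimpleGraph n} → Quadrilateral G → Quadrilateral G → Set
SameQuad q q' = ∀ u v → (EdgeOfQuad u v q → EdgeOfQuad u v q') × (EdgeOfQuad u v q' → EdgeOfQuad u v q)

P2 : ∀ {n} → SimpleGraph n → Set
P2 G = ∀ u v → Adj G u v →
  Σ (Triangle G) λ t → EdgeOfTri u v t × (∀ t' → EdgeOfTri u v t' → SameTri t t')

P3 : ∀ {n} → SimpleGraph n → Set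
P3 G = ∀ u v → Adj (complement G) u v →
  Σ (Quadrilateral (complement G)) λ q → EdgeOfQuad u v q × (∀ q' → EdgeOfQuad u v q' → SameQuad q q')

-- Under (P2) every edge has exactly one common neighbour, its apex. In a
-- quadrilateral a-b-c-d of G this forces the diagonal ac to be a non-edge,
-- and the apexes x of ab and y of bc make a-c-x-y a quadrilateral of G^c;
-- likewise the apexes w of ad and z of dc make a-c-w-z one. Both contain the
-- non-edge ac, so by (P3) they coincide, yet x is none of a, c, w, z.
module Submission where

open import Defs
open import Data.Nat using (ℕ)
open import Data.Fin using (Fin)
open import Data.Empty using (⊥-elim)
open import Data.Product using (_×_; ∃-syntax; _,_; proj₁; proj₂; swap)
open import Data.Sum using (_⊎_; inj₁; inj₂)
open import Relation.Nullary using (¬_)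
open import Relation.Binary.PropositionalEquality using (_≡_; _≢_; refl; ≢-sym)

SameEdge-source : ∀ {n} {u v x y : Fin n} → SameEdge u v x y → u ≡ x ⊎ u ≡ y
SameEdge-source (inj₁ (u≡x , _)) = inj₁ u≡x
SameEdge-source (inj₂ (u≡y , _)) = inj₂ u≡y

EdgeOfQuad-source : ∀ {n} {H : SimpleGraph n} {u v} (q : Quadrilateral H) → EdgeOfQuad u v q →
                    let open Quadrilateral q in u ≡ a ⊎ u ≡ b ⊎ u ≡ c ⊎ u ≡ d
EdgeOfQuad-source _ (inj₁ e)                   with SameEdge-source e
... | inj₁ u≡a = inj₁ u≡a
... | inj₂ u≡b = inj₂ (inj₁ u≡b)
EdgeOfQuad-source _ (inj₂ (inj₁ e))            with SameEdge-source e
... | inj₁ u≡b = inj₂ (inj₁ u≡b)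
... | inj₂ u≡c = inj₂ (inj₂ (inj₁ u≡c))
EdgeOfQuad-source _ (inj₂ (inj₂ (inj₁ e)))     with SameEdge-source e
... | inj₁ u≡c = inj₂ (inj₂ (inj₁ u≡c))
... | inj₂ u≡d = inj₂ (inj₂ (inj₂ u≡d))
EdgeOfQuad-source _ (inj₂ (inj₂ (inj₂ e)))     with SameEdge-source e
... | inj₁ u≡d = inj₂ (inj₂ (inj₂ u≡d))
... | inj₂ u≡a = inj₁ u≡a

module _ {n : ℕ} (G : SimpleGraph n) where

  CommonNeighbour : Fin n → Fin n → Fin n → Set
  CommonNeighbour u v x = Adj G u x × Adj G v x

  Adj⇒≢ : ∀ {u v} → Adj G u v → u ≢ v
  Adj⇒≢ uv refl = irrefl G uv

  separated⇒≢ : ∀ {u v t} → Adj G u t → ¬ Adj G v t → u ≢ v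
  separated⇒≢ ut ¬vt refl = ¬vt ut

  separated⇒complement : ∀ {u v t} → ¬ Adj G u v → Adj G u t → ¬ Adj G v t → Adj (complement G) u v
  separated⇒complement ¬uv ut ¬vt = separated⇒≢ ut ¬vt , ¬uv

  SameEdge-commonNeighbour : ∀ {u v α β γ} → SameEdge u v α β →
                             CommonNeighbour α β γ → CommonNeighbour u v γ
  SameEdge-commonNeighbour (inj₁ (refl , refl)) αβγ = αβγ
  SameEdge-commonNeighbour (inj₂ (refl , refl)) αβγ = swap αβγ

  module _ (p2 : P2 G) where

    apex : ∀ {u v} → Adj G u v → ∃[ x ] CommonNeighbour u v x
    apex {u} {v} uv with p2 u v uv
    ... | tri a b c ab bc ca , inj₁ e , _        = c , SameEdge-commonNeighbour e (symm G ca , bc)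
    ... | tri a b c ab bc ca , inj₂ (inj₁ e) , _ = a , SameEdge-commonNeighbour e (symm G ab , ca)
    ... | tri a b c ab bc ca , inj₂ (inj₂ e) , _ = b , SameEdge-commonNeighbour e (symm G bc , ab)

    triangles-sharing-edge-agree : ∀ {u v s t} (t₁ t₂ : Triangle G) → Adj G u v →
                                   EdgeOfTri u v t₁ → EdgeOfTri u v t₂ →
                                   EdgeOfTri s t t₁ → EdgeOfTri s t t₂
    triangles-sharing-edge-agree {u} {v} {s} {t} t₁ t₂ uv e₁ e₂ st with p2 u v uv
    ... | _ , _ , unique = proj₁ (unique t₂ e₂ s t) (proj₂ (unique t₁ e₁ s t) st)

    commonNeighbour-unique : ∀ {u v x y} → Adj G u v →
                             CommonNeighbour u v x → CommonNeighbour u v y → x ≡ y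
    commonNeighbour-unique {u} {v} {x} {y} uv (ux , vx) (uy , vy)
      with triangles-sharing-edge-agree (tri u v x uv vx (symm G ux)) (tri u v y uv vy (symm G uy)) uv
             (inj₁ (inj₁ (refl , refl))) (inj₁ (inj₁ (refl , refl))) (inj₂ (inj₂ (inj₁ (refl , refl))))
    ... | inj₁ (inj₁ (refl , _))        = ⊥-elim (irrefl G ux)
    ... | inj₁ (inj₂ (refl , _))        = ⊥-elim (irrefl G vx)
    ... | inj₂ (inj₁ (inj₁ (refl , _))) = ⊥-elim (irrefl G vx)
    ... | inj₂ (inj₁ (inj₂ (x≡y , _)))  = x≡y
    ... | inj₂ (inj₂ (inj₁ (x≡y , _)))  = x≡y
    ... | inj₂ (inj₂ (inj₂ (refl , _))) = ⊥-elim (irrefl G ux)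

    apex-¬adj : ∀ {u v w x} → Adj G u v → Adj G v w → u ≢ w → CommonNeighbour u v x → ¬ Adj G x w
    apex-¬adj uv vw u≢w (ux , vx) xw =
      u≢w (commonNeighbour-unique vx (symm G uv , symm G ux) (vw , xw))

    diagonal-¬adj : ∀ {a b c d} → b ≢ d → Adj G a b → Adj G b c → Adj G c d → Adj G d a → ¬ Adj G a c
    diagonal-¬adj b≢d ab bc cd da ac =
      b≢d (commonNeighbour-unique ac (ab , symm G bc) (symm G da , cd))

    apex-square : ∀ {a b c x y} → Adj (complement G) a c → Adj G a b → Adj G b c →
                  CommonNeighbour a b x → CommonNeighbour b c y → Quadrilateral (complement G)
    apex-square {a} {b} {c} {x} {y} (a≢c , ¬ac) ab bc (ax , bx) (by , cy) =
      quad a c x y (Adj⇒≢ ax) (Adj⇒≢ cy)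
        (a≢c , ¬ac)
        (separated⇒complement (λ cx → ¬xc (symm G cx)) cy ¬xy)
        (separated⇒complement ¬xy (symm G ax) ¬ya)
        (separated⇒complement ¬ya (symm G cy) ¬ac)
      where
      ¬xc : ¬ Adj G x c
      ¬xc = apex-¬adj ab bc a≢c (ax , bx)
      ¬ya : ¬ Adj G y a
      ¬ya = apex-¬adj (symm G bc) (symm G ab) (≢-sym a≢c) (cy , by)
      ¬xy : ¬ Adj G x y
      ¬xy = apex-¬adj ab by (≢-sym (separated⇒≢ (symm G cy) ¬ac)) (ax , bx)

quadrilaterals-sharing-edge-agree : ∀ {n} {G : SimpleGraph n} → P3 G → ∀ {u v s t} →
                                    (q₁ q₂ : Quadrilateral (complement G)) → Adj (complement G) u v →
                                    EdgeOfQuad u v q₁ → EdgeOfQuad u v q₂ →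
                                    EdgeOfQuad s t q₁ → EdgeOfQuad s t q₂
quadrilaterals-sharing-edge-agree p3 {u} {v} {s} {t} q₁ q₂ uv e₁ e₂ st with p3 u v uv
... | _ , _ , unique = proj₁ (unique q₂ e₂ s t) (proj₂ (unique q₁ e₁ s t) st)

lemma2 : (n : ℕ) (G : SimpleGraph n) → P2 G → P3 G → ¬ Quadrilateral G
lemma2 n G p2 p3 (quad a b c d a≢c b≢d ab bc cd da)
  with apex G p2 ab | apex G p2 bc | apex G p2 (symm G da) | apex G p2 (symm G cd)
... | x , ax , bx | y , by , cy | w , aw , dw | z , dz , cz =
  x∉Q₂ (EdgeOfQuad-source Q₂ xy∈Q₂)
  where
  ¬ac : ¬ Adj G a c
  ¬ac = diagonal-¬adj G p2 b≢d ab bc cd da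
  ac : Adj (complement G) a c
  ac = a≢c , ¬ac
  Q₁ Q₂ : Quadrilateral (complement G)
  Q₁ = apex-square G p2 ac ab bc (ax , bx) (by , cy)
  Q₂ = apex-square G p2 ac (symm G da) (symm G cd) (aw , dw) (dz , cz)

  xy∈Q₂ : EdgeOfQuad x y Q₂
  xy∈Q₂ = quadrilaterals-sharing-edge-agree {G = G} p3 Q₁ Q₂ ac
            (inj₁ (inj₁ (refl , refl))) (inj₁ (inj₁ (refl , refl))) (inj₂ (inj₂ (inj₁ (inj₁ (refl , refl)))))

  x∉Q₂ : ¬ (x ≡ a ⊎ x ≡ c ⊎ x ≡ w ⊎ x ≡ z)
  x∉Q₂ (inj₁ refl)               = irrefl G ax
  x∉Q₂ (inj₂ (inj₁ refl))        = ¬ac ax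
  x∉Q₂ (inj₂ (inj₂ (inj₁ refl))) = apex-¬adj G p2 (symm G ab) (symm G da) b≢d (bx , ax) (symm G dw)
  x∉Q₂ (inj₂ (inj₂ (inj₂ refl))) = apex-¬adj G p2 ab bc a≢c (ax , bx) (symm G cz)
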